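{- Let $T$ be a tree with vertex set $\{1,\ldots,n\}$, and for $x\le y$ say $x\in potBeg(y)$ iff every vertex of $\{x,\ldots,y\}$ lies in the connected component of $x$ in $T_{\ge x}$. Let $2\le y\le n$ and let $x<x'$ both belong to $potBeg(y-1)$. If $x'\in potBeg(y)$, then $x\in potBeg(y)$.
   Context: $T_{\ge x}$ denotes the subgraph of $T$ induced by $\{x,x+1,\ldots,n\}$. -}

module Defs where

open import Data.Nat using (ℕ; _≤_; _<_)
open import Data.List using (List; []; _∷_; _++_; [_]; length)
open import Data.List.Relation.Unary.Linked using (Linked)
open import Data.List.Relation.Unary.Unique.Propositional using (Unique)
open import Data.Product using (_×_; Σ; ∃)
open import Relation.Nullary using (¬_)
open import Level using (0ℓ; suc)

record Graph (n : ℕ) : Set₁ where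
  field
    Adj     : ℕ → ℕ → Set
    sym     : ∀ {u v} → Adj u v → Adj v u
    irrefl  : ∀ {u} → ¬ Adj u u
    inRange : ∀ {u v} → Adj u v → (1 ≤ u × u ≤ n)
open Graph public

Vertex : ℕ → ℕ → Set
Vertex n v = 1 ≤ v × v ≤ n

-- Walks from u to w in G all of whose vertices satisfy S
-- (i.e. walks in the subgraph induced by S).
data WalkIn {n : ℕ} (G : Graph n) (S : ℕ → Set) : ℕ → ℕ → Set where
  here : ∀ {u} → S u → WalkIn G S u u
  step : ∀ {u v w} → S u → Adj G u v → WalkIn G S v w → WalkIn G S u w

Connected : ∀ {n} → Graph n → Set
Connected {n} G = ∀ u v → Vertex n u → Vertex n v → WalkIn G (Vertex n) u v

IsCycle : ∀ {n} → Graph n → List ℕ → Set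
IsCycle G [] = Data.Empty.⊥ where import Data.Empty
IsCycle G (u ∷ vs) = 3 ≤ length (u ∷ vs) × Unique (u ∷ vs) × Linked (Adj G) ((u ∷ vs) ++ [ u ])

Acyclic : ∀ {n} → Graph n → Set
Acyclic G = ∀ c → ¬ IsCycle G c

IsTree : ∀ {n} → Graph n → Set
IsTree G = Connected G × Acyclic G

Geq : ℕ → ℕ → ℕ → Set
Geq n x v = x ≤ v × v ≤ n

InCompGeq : ∀ {n} → Graph n → ℕ → ℕ → Set
InCompGeq {n} G x v = WalkIn G (Geq n x) x v

PotBeg : ∀ {n} → Graph n → ℕ → ℕ → Set
PotBeg {n} G y x =
  Vertex n x × Vertex n y × x ≤ y × (∀ z → x ≤ z → z ≤ y → InCompGeq G x z)

module Submission where

-- Only the new vertex y needs attention: every z with x ≤ z ≤ y ∸ 1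
-- is already reached from x inside T_{≥x} because x ∈ potBeg(y ∸ 1), and the
-- only remaining z ≤ y is z = y itself.  To reach y, first walk from x to x′
-- inside T_{≥x} (x′ ≤ y ∸ 1, so this uses x ∈ potBeg(y ∸ 1)), then walk from
-- x′ to y inside T_{≥x′} (x′ ∈ potBeg(y)); since x < x′ the second walk also
-- lies in T_{≥x}, and concatenating the two gives the required walk.

open import Defs
open import Data.Nat using (ℕ; zero; suc; z≤n; _≤_; _<_; _∸_; _≤?_)
open import Data.Nat.Properties using (≤-trans; <⇒≤; ≰⇒>; ≤-antisym; m∸n≤m; ≤-refl)
open import Data.Product using (_,_)
open import Relation.Nullary using (yes; no)
open import Relation.Binary.PropositionalEquality using (_≡_; refl)

walk-mono : ∀ {n} {G : Graph n} {S S′ : ℕ → Set} → (∀ {v} → S v → S′ v) →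
            ∀ {u w} → WalkIn G S u w → WalkIn G S′ u w
walk-mono S⊆S′ (here su)        = here (S⊆S′ su)
walk-mono S⊆S′ (step su adj p)  = step (S⊆S′ su) adj (walk-mono S⊆S′ p)

walk-++ : ∀ {n} {G : Graph n} {S : ℕ → Set} {u v w} →
          WalkIn G S u v → WalkIn G S v w → WalkIn G S u w
walk-++ (here _)        q = q
walk-++ (step su adj p) q = step su adj (walk-++ p q)

Geq-anti : ∀ {n x x′} → x ≤ x′ → ∀ {v} → Geq n x′ v → Geq n x v
Geq-anti x≤x′ (x′≤v , v≤n) = ≤-trans x≤x′ x′≤v , v≤n

above-pred-is-top : ∀ y z → z ≤ y → y ∸ 1 < z → z ≡ y
above-pred-is-top zero    z z≤y _     = ≤-antisym z≤y z≤n
above-pred-is-top (suc y) z z≤y y<z   = ≤-antisym z≤y y<z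

mainTheorem7 : ∀ (n : ℕ) (T : Graph n) → IsTree T →
    ∀ (y x x′ : ℕ) → 2 ≤ y → y ≤ n → x < x′ →
    PotBeg T (y ∸ 1) x → PotBeg T (y ∸ 1) x′ →
    PotBeg T y x′ → PotBeg T y x
mainTheorem7 n T _ y x x′ _ _ x<x′
             (vx , _ , x≤y∸1 , reach-x) (_ , _ , x′≤y∸1 , _) (_ , vy , x′≤y , reach-x′) =
  vx , vy , ≤-trans x≤y∸1 (m∸n≤m y 1) , reach
  where
  x⇝y : InCompGeq T x y
  x⇝y = walk-++ (reach-x x′ (<⇒≤ x<x′) x′≤y∸1)
                (walk-mono (Geq-anti (<⇒≤ x<x′)) (reach-x′ y x′≤y ≤-refl))

  reach : ∀ z → x ≤ z → z ≤ y → InCompGeq T x z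
  reach z x≤z z≤y with z ≤? y ∸ 1
  ... | yes z≤y∸1 = reach-x z x≤z z≤y∸1
  ... | no  z≰y∸1 with above-pred-is-top y z z≤y (≰⇒> z≰y∸1)
  ...   | refl = x⇝y
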